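{- Let $C_{2n+1}$ be the odd cycle with vertex set $V=\{v_1,\ldots,v_{2n+1}\}$ ($v_i$ adjacent to $v_{i+1}$, indices mod $2n+1$). A nonempty set $A\subseteq V$ is a center set of $C_{2n+1}$ if and only if either $A=V$ or $A$ does not contain a pair of alternate vertices, i.e. there is no $i$ with both $v_i\in A$ and $v_{i+2}\in A$ (indices mod $2n+1$).
   Context: $d$ is shortest-path distance. For nonempty $S\subseteq V$, $e_S(v)=\max_{x\in S}d(v,x)$ and $C_S(G)=\{v\in V: e_S(v)\le e_S(x)\ \forall x\in V\}$. A set $A\subseteq V$ is a center set of $G$ if $A=C_S(G)$ for some nonempty $S\subseteq V$. -}

module Defs where

open import Data.Nat using (ℕ; zero; suc; _+_; _*_; _≤_; _⊔_)
open import Data.Nat.DivMod using (_%_; m%n<n)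
open import Data.Fin using (Fin; toℕ; fromℕ<)
open import Data.Fin.Subset using (Subset; _∈_; Nonempty; ⊤)
open import Data.List using (foldr; map)
open import Data.List.Base using (allFin)
open import Data.Bool using (if_then_else_)
open import Data.Vec using (lookup)
open import Data.Product using (Σ; _×_; ∃)
open import Data.Sum using (_⊎_)
open import Function.Bundles using (_⇔_)
open import Relation.Nullary using (¬_)
open import Relation.Binary.PropositionalEquality using (_≡_)

Graph : ℕ → Set₁
Graph m = Fin m → Fin m → Set

data Walk {m : ℕ} (G : Graph m) : Fin m → Fin m → ℕ → Set where
  here : ∀ {u} → Walk G u u 0
  step : ∀ {u w v k} → G u w → Walk G w v k → Walk G u v (suc k)

IsShortestPathDistance : ∀ {m} → Graph m → (Fin m → Fin m → ℕ) → Set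
IsShortestPathDistance G d =
  ∀ u v → Walk G u v (d u v) × (∀ k → Walk G u v k → d u v ≤ k)

-- eccentricity e_S(v) = max_{x ∈ S} d(v,x)  (for nonempty S; distances are ≥ 0)
ecc : ∀ {m} → (Fin m → Fin m → ℕ) → Subset m → Fin m → ℕ
ecc {m} d S v = foldr _⊔_ 0 (map (λ x → if lookup S x then d v x else 0) (allFin m))

InCenter : ∀ {m} → (Fin m → Fin m → ℕ) → Subset m → Fin m → Set
InCenter {m} d S v = ∀ (x : Fin m) → ecc d S v ≤ ecc d S x

IsCenterSet : ∀ {m} → (Fin m → Fin m → ℕ) → Subset m → Set
IsCenterSet {m} d A = Σ (Subset m) λ S → Nonempty S × (∀ v → (v ∈ A ⇔ InCenter d S v))

-- index successor mod (suc k); vertex v_{i+1} is Fin i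
next : ∀ {k} → Fin (suc k) → Fin (suc k)
next {k} i = fromℕ< (m%n<n (suc (toℕ i)) (suc k))

OddCycle : (n : ℕ) → Graph (suc (2 * n))
OddCycle n i j = (j ≡ next i) ⊎ (i ≡ next j)

NoAlternatePair : ∀ {k} → Subset (suc k) → Set
NoAlternatePair {k} A = ¬ (∃ λ (i : Fin (suc k)) → (i ∈ A) × (next (next i) ∈ A))

-- On C_(2n+1) the distance from v to x is the length of the shorter arc between them.
-- Hence every eccentricity is at most n, d(v,x) = n exactly when v is one of the two
-- vertices opposite x, and along three consecutive vertices the distance to a fixed vertex
-- has no strict local maximum below n. If two centres i and i+2 had eccentricity < n, the
-- middle vertex i+1 would have strictly smaller eccentricity; so a centre set containing an
-- alternate pair has eccentricity n, the maximum, and is all of V. Conversely, if A has no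
-- alternate pair, let S be the set of vertices whose two opposite vertices both lie outside A.
-- Vertices of A then have eccentricity < n, vertices outside A have eccentricity n (A has no
-- alternate pair, so every vertex outside A lies in an edge outside A, which is opposite some
-- x ∈ S), and every vertex of A has a neighbour outside A; hence C_S = A.

module Submission where

open import Defs
open import Data.Bool using (true; false; if_then_else_)
open import Data.Fin using (Fin; toℕ; zero)
open import Data.Fin.Properties using (toℕ-injective; toℕ<n; toℕ-fromℕ<; any?; ¬∀⟶∃¬)
open import Data.Fin.Subset using (Subset; _∈_; _∉_; Nonempty; ⊤)
open import Data.Fin.Subset.Properties using (_∈?_; ∈⊤; ⊆-antisym)
open import Data.List.Properties using (foldr-preservesᵇ; foldr-preservesᵒ)
import Data.List.Relation.Unary.All.Properties as All
import Data.List.Relation.Unary.Any.Properties as Any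
open import Data.Nat
open import Data.Nat.Properties
open import Data.Nat.DivMod
open import Data.Product using (∃; _,_; _×_; proj₁; proj₂)
open import Data.Sum using (_⊎_; inj₁; inj₂; [_,_])
open import Data.Vec using (lookup; tabulate)
open import Data.Vec.Properties using ([]=⇒lookup; lookup⇒[]=; lookup∘tabulate)
open import Function.Bundles using (_⇔_; mk⇔; Equivalence)
open import Relation.Nullary using (Dec; yes; no; does; contradiction)
open import Relation.Unary using (Decidable)
open import Relation.Nullary.Decidable using (dec-true; ¬?; _×-dec_)
open import Relation.Binary.PropositionalEquality using (_≡_; _≢_; refl; sym; trans; cong; subst; subst₂; module ≡-Reasoning)

module _ {m : ℕ} (d : Fin m → Fin m → ℕ) (S : Subset m) where

  dist≤ecc : ∀ {v x} → x ∈ S → d v x ≤ ecc d S v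
  dist≤ecc {v} {x} x∈S =
    foldr-preservesᵒ {P = d v x ≤_} {f = _⊔_} ≤-⊔ 0 _ (inj₂ (Any.map⁺ (Any.tabulate⁺ x (≤-reflexive (sym weight≡)))))
    where
    ≤-⊔ : ∀ a b → d v x ≤ a ⊎ d v x ≤ b → d v x ≤ a ⊔ b
    ≤-⊔ a b = [ (λ p → ≤-trans p (m≤m⊔n a b)) , (λ p → ≤-trans p (m≤n⊔m a b)) ]
    weight≡ : (if lookup S x then d v x else 0) ≡ d v x
    weight≡ rewrite []=⇒lookup x∈S = refl

  -- Vertices outside S contribute 0 to the maximum, whence the hypothesis P 0.
  ecc-preserves : (P : ℕ → Set) → (∀ {a b} → P a → P b → P (a ⊔ b)) → P 0 →
                  ∀ {v} → (∀ {x} → x ∈ S → P (d v x)) → P (ecc d S v)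
  ecc-preserves P P-⊔ P0 {v} P-d = foldr-preservesᵇ {P = P} {f = _⊔_} P-⊔ P0 (All.map⁺ (All.tabulate⁺ P-weight))
    where
    P-weight : ∀ x → P (if lookup S x then d v x else 0)
    P-weight x with lookup S x in eq
    ... | true  = P-d (lookup⇒[]= x S eq)
    ... | false = P0

  ecc-lub : ∀ {v b} → (∀ {x} → x ∈ S → d v x ≤ b) → ecc d S v ≤ b
  ecc-lub {b = b} = ecc-preserves (_≤ b) ⊔-lub z≤n

  ecc-lub< : Nonempty S → ∀ {v b} → (∀ {x} → x ∈ S → d v x < b) → ecc d S v < b
  ecc-lub< (x , x∈S) {b = b} bound = ecc-preserves (_< b) ⊔-lub (≤-<-trans z≤n (bound x∈S)) bound

module _ {m : ℕ} {G : Graph m} where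

  _▷_ : ∀ {u v w k} → Walk G u v k → G v w → Walk G u w (suc k)
  here       ▷ e = step e here
  step e′ p  ▷ e = step e′ (p ▷ e)

  walk-length≥ : (f : Fin m → Fin m → ℕ) → (∀ v → f v v ≡ 0) →
                 (∀ {u w} v → G u w → f u v ≤ suc (f w v)) →
                 ∀ {u v k} → Walk G u v k → f u v ≤ k
  walk-length≥ f f-diag f-edge {u} here       = ≤-reflexive (f-diag u)
  walk-length≥ f f-diag f-edge     (step e p) = ≤-trans (f-edge _ e) (s≤s (walk-length≥ f f-diag f-edge p))

  module _ {d : Fin m → Fin m → ℕ} (isDist : IsShortestPathDistance G d) where

    shortestPathDistance-unique : (f : Fin m → Fin m → ℕ) → (∀ u v → Walk G u v (f u v)) →
                                  (∀ v → f v v ≡ 0) → (∀ {u w} v → G u w → f u v ≤ suc (f w v)) →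
                                  ∀ u v → d u v ≡ f u v
    shortestPathDistance-unique f f-walk f-diag f-edge u v =
      ≤-antisym (proj₂ (isDist u v) _ (f-walk u v)) (walk-length≥ f f-diag f-edge (proj₁ (isDist u v)))

    dist-edge : ∀ {u w} v → G u w → d u v ≤ suc (d w v)
    dist-edge {u} v e = proj₂ (isDist u v) _ (step e (proj₁ (isDist _ v)))

    ecc-edge : ∀ S {u w} → G u w → ecc d S u ≤ suc (ecc d S w)
    ecc-edge S e = ecc-lub d S (λ x∈S → ≤-trans (dist-edge _ e) (s≤s (dist≤ecc d S x∈S)))

module _ {m : ℕ} {P : Fin m → Set} (P? : Decidable P) where

  subsetOf : Subset m
  subsetOf = tabulate (λ x → does (P? x))

  ∈-subsetOf⁺ : ∀ {x} → P x → x ∈ subsetOf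
  ∈-subsetOf⁺ {x} px = lookup⇒[]= x subsetOf (trans (lookup∘tabulate _ x) (dec-true (P? x) px))

  ∈-subsetOf⁻ : ∀ {x} → x ∈ subsetOf → P x
  ∈-subsetOf⁻ {x} x∈ = witness (P? x) (trans (sym (lookup∘tabulate _ x)) ([]=⇒lookup x∈))
    where
    witness : (p? : Dec (P x)) → does p? ≡ true → P x
    witness (yes px) _ = px

[m%d+n]%d≡[m+n]%d : ∀ m n d .{{_ : NonZero d}} → (m % d + n) % d ≡ (m + n) % d
[m%d+n]%d≡[m+n]%d m n d = begin
  (m % d + n) % d          ≡⟨ %-distribˡ-+ (m % d) n d ⟩
  (m % d % d + n % d) % d  ≡⟨ cong (λ a → (a + n % d) % d) (m%n%n≡m%n m d) ⟩
  (m % d + n % d) % d      ≡⟨ %-distribˡ-+ m n d ⟨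
  (m + n) % d              ∎
  where open ≡-Reasoning

[m+n%d]%d≡[m+n]%d : ∀ m n d .{{_ : NonZero d}} → (m + n % d) % d ≡ (m + n) % d
[m+n%d]%d≡[m+n]%d m n d = begin
  (m + n % d) % d  ≡⟨ cong (_% d) (+-comm m (n % d)) ⟩
  (n % d + m) % d  ≡⟨ [m%d+n]%d≡[m+n]%d n m d ⟩
  (n + m) % d      ≡⟨ cong (_% d) (+-comm n m) ⟩
  (m + n) % d      ∎
  where open ≡-Reasoning

module Rotation (k : ℕ) where

  private
    N : ℕ
    N = suc k

  rotate : ℕ → Fin N → Fin N
  rotate zero    i = i
  rotate (suc r) i = rotate r (next i)

  toℕ-next : ∀ (i : Fin N) → toℕ (next i) ≡ suc (toℕ i) % N
  toℕ-next i = toℕ-fromℕ< _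

  toℕ-rotate : ∀ r (i : Fin N) → toℕ (rotate r i) ≡ (toℕ i + r) % N
  toℕ-rotate zero i = begin
    toℕ i            ≡⟨ m<n⇒m%n≡m (toℕ<n i) ⟨
    toℕ i % N        ≡⟨ cong (_% N) (+-identityʳ (toℕ i)) ⟨
    (toℕ i + 0) % N  ∎
    where open ≡-Reasoning
  toℕ-rotate (suc r) i = begin
    toℕ (rotate r (next i))    ≡⟨ toℕ-rotate r (next i) ⟩
    (toℕ (next i) + r) % N     ≡⟨ cong (λ a → (a + r) % N) (toℕ-next i) ⟩
    (suc (toℕ i) % N + r) % N  ≡⟨ [m%d+n]%d≡[m+n]%d (suc (toℕ i)) r N ⟩
    (suc (toℕ i) + r) % N      ≡⟨ cong (_% N) (+-suc (toℕ i) r) ⟨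
    (toℕ i + suc r) % N        ∎
    where open ≡-Reasoning

  rotate-cong : ∀ {a b} (i : Fin N) → a % N ≡ b % N → rotate a i ≡ rotate b i
  rotate-cong {a} {b} i a≡b = toℕ-injective (begin
    toℕ (rotate a i)  ≡⟨ toℕ-rotate a i ⟩
    (toℕ i + a) % N   ≡⟨ [m+n%d]%d≡[m+n]%d (toℕ i) a N ⟨
    (toℕ i + a % N) % N  ≡⟨ cong (λ c → (toℕ i + c) % N) a≡b ⟩
    (toℕ i + b % N) % N  ≡⟨ [m+n%d]%d≡[m+n]%d (toℕ i) b N ⟩
    (toℕ i + b) % N   ≡⟨ toℕ-rotate b i ⟨
    toℕ (rotate b i)  ∎)
    where open ≡-Reasoning

  rotate-+ : ∀ a b (i : Fin N) → rotate a (rotate b i) ≡ rotate (b + a) i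
  rotate-+ a zero    i = refl
  rotate-+ a (suc b) i = rotate-+ a b (next i)

  rotate-period : ∀ (i : Fin N) → rotate N i ≡ i
  rotate-period i = rotate-cong {N} {0} i (n%n≡0 N)

  offset : Fin N → Fin N → ℕ
  offset y x = (toℕ y + (N ∸ toℕ x)) % N

  offset<N : ∀ (y x : Fin N) → offset y x < N
  offset<N y x = m%n<n (toℕ y + (N ∸ toℕ x)) N

  private
    x+[N∸x]≡N : ∀ (x : Fin N) → toℕ x + (N ∸ toℕ x) ≡ N
    x+[N∸x]≡N x = m+[n∸m]≡n (<⇒≤ (toℕ<n x))

  offset-next : ∀ (y x : Fin N) → offset (next y) x ≡ suc (offset y x) % N
  offset-next y x = begin
    (toℕ (next y) + (N ∸ toℕ x)) % N     ≡⟨ cong (λ a → (a + (N ∸ toℕ x)) % N) (toℕ-next y) ⟩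
    (suc (toℕ y) % N + (N ∸ toℕ x)) % N  ≡⟨ [m%d+n]%d≡[m+n]%d (suc (toℕ y)) _ N ⟩
    suc (toℕ y + (N ∸ toℕ x)) % N        ≡⟨ [m+n%d]%d≡[m+n]%d 1 _ N ⟨
    suc (offset y x) % N                 ∎
    where open ≡-Reasoning

  offset-rotate : ∀ r (x : Fin N) → offset (rotate r x) x ≡ r % N
  offset-rotate r x = begin
    (toℕ (rotate r x) + (N ∸ toℕ x)) % N     ≡⟨ cong (λ a → (a + (N ∸ toℕ x)) % N) (toℕ-rotate r x) ⟩
    ((toℕ x + r) % N + (N ∸ toℕ x)) % N      ≡⟨ [m%d+n]%d≡[m+n]%d (toℕ x + r) _ N ⟩
    (toℕ x + r + (N ∸ toℕ x)) % N            ≡⟨ cong (_% N) (+-comm (toℕ x + r) _) ⟩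
    ((N ∸ toℕ x) + (toℕ x + r)) % N          ≡⟨ cong (_% N) (+-assoc (N ∸ toℕ x) (toℕ x) r) ⟨
    ((N ∸ toℕ x) + toℕ x + r) % N            ≡⟨ cong (λ a → (a + r) % N) (trans (+-comm _ (toℕ x)) (x+[N∸x]≡N x)) ⟩
    (N + r) % N                              ≡⟨ cong (_% N) (+-comm N r) ⟩
    (r + N) % N                              ≡⟨ [m+n]%n≡m%n r N ⟩
    r % N                                    ∎
    where open ≡-Reasoning

  rotate-offset : ∀ (y x : Fin N) → rotate (offset y x) x ≡ y
  rotate-offset y x = toℕ-injective (begin
    toℕ (rotate (offset y x) x)                ≡⟨ toℕ-rotate (offset y x) x ⟩
    (toℕ x + offset y x) % N                   ≡⟨ [m+n%d]%d≡[m+n]%d (toℕ x) _ N ⟩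
    (toℕ x + (toℕ y + (N ∸ toℕ x))) % N        ≡⟨ cong (_% N) (+-comm (toℕ x) _) ⟩
    (toℕ y + (N ∸ toℕ x) + toℕ x) % N          ≡⟨ cong (_% N) (+-assoc (toℕ y) _ (toℕ x)) ⟩
    (toℕ y + ((N ∸ toℕ x) + toℕ x)) % N        ≡⟨ cong (λ a → (toℕ y + a) % N) (trans (+-comm _ (toℕ x)) (x+[N∸x]≡N x)) ⟩
    (toℕ y + N) % N                            ≡⟨ [m+n]%n≡m%n (toℕ y) N ⟩
    toℕ y % N                                  ≡⟨ m<n⇒m%n≡m (toℕ<n y) ⟩
    toℕ y                                      ∎)
    where open ≡-Reasoning

module ShorterArc (n : ℕ) where

  N : ℕ
  N = suc (2 * n)

  arc : ℕ → ℕ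
  arc o = o ⊓ (N ∸ o)

  sucMod : ℕ → ℕ
  sucMod o = suc o % N

  N≡1+n+n : N ≡ suc n + n
  N≡1+n+n = cong (λ t → suc (n + t)) (+-identityʳ n)

  private
    n<N : n < N
    n<N = subst (n <_) (sym N≡1+n+n) (s≤s (m≤m+n n n))

    N∸[1+n+j]≡n∸j : ∀ j → N ∸ (suc n + j) ≡ n ∸ j
    N∸[1+n+j]≡n∸j j = trans (cong (_∸ (suc n + j)) N≡1+n+n) ([m+n]∸[m+o]≡n∸o (suc n) n j)

    sucMod-< : ∀ {o} → suc o < N → sucMod o ≡ suc o
    sucMod-< = m<n⇒m%n≡m

  arc-low : ∀ {o} → o ≤ n → arc o ≡ o
  arc-low {o} o≤n = m≤n⇒m⊓n≡m (begin
    o              ≤⟨ m≤n⇒m≤1+n o≤n ⟩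
    suc n          ≡⟨ m+n∸n≡m (suc n) n ⟨
    suc n + n ∸ n  ≡⟨ cong (_∸ n) N≡1+n+n ⟨
    N ∸ n          ≤⟨ ∸-monoʳ-≤ N o≤n ⟩
    N ∸ o          ∎)
    where open ≤-Reasoning

  arc-high : ∀ j → arc (suc n + j) ≡ n ∸ j
  arc-high j = trans (cong ((suc n + j) ⊓_) (N∸[1+n+j]≡n∸j j))
                     (m≥n⇒m⊓n≡n (≤-trans (m∸n≤m n j) (≤-trans (n≤1+n n) (m≤m+n (suc n) j))))

  data OffsetView : ℕ → Set where
    low  : ∀ {o} → o ≤ n → OffsetView o
    high : ∀ j → j < n → OffsetView (suc n + j)

  offsetView : ∀ {o} → o < N → OffsetView o
  offsetView {o} o<N with o ≤? n
  ... | yes o≤n = low o≤n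
  ... | no  o≰n = subst OffsetView (m+[n∸m]≡n n<o) (high (o ∸ suc n) j<n)
    where
    n<o : n < o
    n<o = ≰⇒> o≰n
    j<n : o ∸ suc n < n
    j<n = +-cancelˡ-< (suc n) _ n (begin-strict
      suc n + (o ∸ suc n)  ≡⟨ m+[n∸m]≡n n<o ⟩
      o                    <⟨ o<N ⟩
      N                    ≡⟨ N≡1+n+n ⟩
      suc n + n            ∎)
      where open ≤-Reasoning

  arc≤n : ∀ {o} → o < N → arc o ≤ n
  arc≤n o<N with offsetView o<N
  ... | low o≤n  = ≤-trans (m⊓n≤m _ _) o≤n
  ... | high j _ = subst (_≤ n) (sym (arc-high j)) (m∸n≤m n j)

  arc≡n⇒n⊎1+n : ∀ {o} → o < N → arc o ≡ n → o ≡ n ⊎ o ≡ suc n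
  arc≡n⇒n⊎1+n o<N arc≡n with offsetView o<N
  ... | low o≤n            = inj₁ (trans (sym (arc-low o≤n)) arc≡n)
  ... | high zero _        = inj₂ (+-identityʳ (suc n))
  ... | high (suc j) 1+j<n = contradiction (trans (sym (arc-high (suc j))) arc≡n)
                                           (<⇒≢ (∸-monoʳ-< z<s (<⇒≤ 1+j<n)))

  arc-n : arc n ≡ n
  arc-n = arc-low ≤-refl

  arc-sucMod-n : arc (sucMod n) ≡ n
  arc-sucMod-n with m≤n⇒m<n∨m≡n (subst (suc n ≤_) (sym N≡1+n+n) (m≤m+n (suc n) n))
  ... | inj₁ 1+n<N = trans (cong arc (trans (sucMod-< 1+n<N) (sym (+-identityʳ (suc n))))) (arc-high 0)
  ... | inj₂ 1+n≡N = begin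
    arc (suc n % N)  ≡⟨ cong (λ t → arc (t % N)) 1+n≡N ⟩
    arc (N % N)      ≡⟨ cong arc (n%n≡0 N) ⟩
    0                ≡⟨ n≡0 ⟨
    n                ∎
    where
    open ≡-Reasoning
    n≡0 : n ≡ 0
    n≡0 = +-cancelˡ-≡ (suc n) n 0 (begin
      suc n + n  ≡⟨ N≡1+n+n ⟨
      N          ≡⟨ 1+n≡N ⟨
      suc n      ≡⟨ +-identityʳ (suc n) ⟨
      suc n + 0  ∎)

  arc-sucMod-high : ∀ {j} → j < n → arc (sucMod (suc n + j)) ≡ n ∸ suc j
  arc-sucMod-high {j} j<n with m≤n⇒m<n∨m≡n j<n
  ... | inj₁ 1+j<n = trans (cong arc (trans (sucMod-< N>) (sym (+-suc (suc n) j)))) (arc-high (suc j))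
    where
    N> : suc (suc n + j) < N
    N> = begin-strict
      suc (suc n + j)  ≡⟨ +-suc (suc n) j ⟨
      suc n + suc j    <⟨ +-monoʳ-< (suc n) 1+j<n ⟩
      suc n + n        ≡⟨ N≡1+n+n ⟨
      N                ∎
      where open ≤-Reasoning
  ... | inj₂ 1+j≡n = begin
    arc (sucMod (suc n + j))  ≡⟨ cong (λ t → arc (t % N)) wrap ⟩
    arc (N % N)               ≡⟨ cong arc (n%n≡0 N) ⟩
    0                         ≡⟨ n∸n≡0 n ⟨
    n ∸ n                     ≡⟨ cong (n ∸_) 1+j≡n ⟨
    n ∸ suc j                 ∎
    where
    open ≡-Reasoning
    wrap : suc (suc n + j) ≡ N
    wrap = trans (sym (+-suc (suc n) j)) (trans (cong (suc n +_) 1+j≡n) (sym N≡1+n+n))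

  -- A rise ends at an offset ≤ n, so it is never followed by a fall: arc has no strict
  -- local maximum below n.
  data Step (o : ℕ) : Set where
    rise : sucMod o ≤ n → arc (sucMod o) ≡ suc (arc o) → Step o
    peak : arc o ≡ n → arc (sucMod o) ≡ n → Step o
    fall : n < o → arc o ≡ suc (arc (sucMod o)) → Step o

  step-arc : ∀ {o} → o < N → Step o
  step-arc o<N with offsetView o<N
  ... | high j j<n = fall (s≤s (m≤m+n n j)) (begin
    arc (suc n + j)                 ≡⟨ arc-high j ⟩
    n ∸ j                           ≡⟨ +-∸-assoc 1 j<n ⟩
    suc (n ∸ suc j)                 ≡⟨ cong suc (arc-sucMod-high j<n) ⟨
    suc (arc (sucMod (suc n + j)))  ∎)
    where open ≡-Reasoning
  ... | low {o} o≤n with m≤n⇒m<n∨m≡n o≤n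
  ...   | inj₁ o<n = rise (subst (_≤ n) (sym sucMod≡) o<n)
                          (trans (cong arc sucMod≡) (trans (arc-low o<n) (cong suc (sym (arc-low o≤n)))))
    where
    sucMod≡ : sucMod o ≡ suc o
    sucMod≡ = sucMod-< (≤-trans (s≤s o<n) n<N)
  ...   | inj₂ o≡n = peak (trans (cong arc o≡n) arc-n) (trans (cong (λ t → arc (sucMod t)) o≡n) arc-sucMod-n)

  arc-sucMod≤ : ∀ {o} → o < N → arc (sucMod o) ≤ suc (arc o)
  arc-sucMod≤ {o} o<N with step-arc o<N
  ... | rise _ e  = ≤-reflexive e
  ... | peak e e′ = m≤n⇒m≤1+n (≤-reflexive (trans e′ (sym e)))
  ... | fall _ e  = subst (λ t → arc (sucMod o) ≤ suc t) (sym e) (m≤n⇒m≤1+n (n≤1+n _))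

  arc≤suc-arc-sucMod : ∀ {o} → o < N → arc o ≤ suc (arc (sucMod o))
  arc≤suc-arc-sucMod {o} o<N with step-arc o<N
  ... | rise _ e  = subst (λ t → arc o ≤ suc t) (sym e) (m≤n⇒m≤1+n (n≤1+n _))
  ... | peak e e′ = m≤n⇒m≤1+n (≤-reflexive (trans e (sym e′)))
  ... | fall _ e  = ≤-reflexive e

  arc-no-local-max : ∀ {o} → o < N → arc o < n → arc (sucMod (sucMod o)) < n →
                     arc (sucMod o) < arc o ⊎ arc (sucMod o) < arc (sucMod (sucMod o))
  arc-no-local-max o<N a<n a″<n with step-arc o<N
  ... | fall _ e    = inj₁ (≤-reflexive (sym e))
  ... | peak e _    = contradiction e (<⇒≢ a<n)
  ... | rise o′≤n _ with step-arc (m%n<n (suc _) N)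
  ...   | rise _ e′   = inj₂ (≤-reflexive (sym e′))
  ...   | peak _ e′   = contradiction e′ (<⇒≢ a″<n)
  ...   | fall n<o′ _ = contradiction o′≤n (<⇒≱ n<o′)

module _ (n : ℕ) where

  open ShorterArc n
  open Rotation (2 * n)

  cycleDist : Fin N → Fin N → ℕ
  cycleDist y x = arc (offset y x)

  walk-forward : ∀ r (y : Fin N) → Walk (OddCycle n) y (rotate r y) r
  walk-forward zero    y = here
  walk-forward (suc r) y = step (inj₁ refl) (walk-forward r (next y))

  walk-backward : ∀ r (x : Fin N) → Walk (OddCycle n) (rotate r x) x r
  walk-backward zero    x = here
  walk-backward (suc r) x = walk-backward r (next x) ▷ inj₂ refl

  walk-arc : ∀ {o} (x : Fin N) → o ≤ N → Walk (OddCycle n) (rotate o x) x (arc o)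
  walk-arc {o} x o≤N with ⊓-sel o (N ∸ o)
  ... | inj₁ arc≡o   = subst (Walk _ (rotate o x) x) (sym arc≡o) (walk-backward o x)
  ... | inj₂ arc≡N∸o = subst₂ (Walk _ (rotate o x)) around (sym arc≡N∸o) (walk-forward (N ∸ o) (rotate o x))
    where
    around : rotate (N ∸ o) (rotate o x) ≡ x
    around = trans (rotate-+ (N ∸ o) o x) (trans (cong (λ t → rotate t x) (m+[n∸m]≡n o≤N)) (rotate-period x))

  cycleDist-walk : ∀ y x → Walk (OddCycle n) y x (cycleDist y x)
  cycleDist-walk y x = subst (λ z → Walk _ z x (cycleDist y x)) (rotate-offset y x)
                             (walk-arc x (<⇒≤ (offset<N y x)))

  cycleDist-diag : ∀ x → cycleDist x x ≡ 0
  cycleDist-diag x = cong arc (offset-rotate 0 x)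

  cycleDist-edge : ∀ {u w} x → OddCycle n u w → cycleDist u x ≤ suc (cycleDist w x)
  cycleDist-edge {u} x (inj₁ refl) = subst (λ t → arc (offset u x) ≤ suc (arc t)) (sym (offset-next u x))
                                           (arc≤suc-arc-sucMod (offset<N u x))
  cycleDist-edge {w = w} x (inj₂ refl) = subst (λ t → arc t ≤ suc (arc (offset w x))) (sym (offset-next w x))
                                               (arc-sucMod≤ (offset<N w x))

  antipode⁻ antipode⁺ : Fin N → Fin N
  antipode⁻ x = rotate n x
  antipode⁺ x = rotate (suc n) x

  antipode⁻∘antipode⁺ : ∀ u → antipode⁻ (antipode⁺ u) ≡ u
  antipode⁻∘antipode⁺ u = trans (rotate-+ n (suc n) u) (trans (cong (λ t → rotate t u) (sym N≡1+n+n)) (rotate-period u))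

  antipode⁺∘antipode⁺ : ∀ u → antipode⁺ (antipode⁺ u) ≡ next u
  antipode⁺∘antipode⁺ u = trans (rotate-+ (suc n) (suc n) u) (rotate-cong {suc n + suc n} {1} u (begin
    (suc n + suc n) % N  ≡⟨ cong (_% N) (trans (+-suc (suc n) n) (cong suc (sym N≡1+n+n))) ⟩
    (1 + N) % N          ≡⟨ [m+n]%n≡m%n 1 N ⟩
    1 % N                ∎))
    where open ≡-Reasoning

  prev : Fin N → Fin N
  prev v = rotate (2 * n) v

  next-prev : ∀ v → next (prev v) ≡ v
  next-prev v = trans (rotate-+ 1 (2 * n) v) (trans (cong (λ t → rotate t v) (+-comm (2 * n) 1)) (rotate-period v))

  module _ {d : Fin N → Fin N → ℕ} (isDist : IsShortestPathDistance (OddCycle n) d) where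

    dist≡cycleDist : ∀ u v → d u v ≡ cycleDist u v
    dist≡cycleDist = shortestPathDistance-unique isDist cycleDist cycleDist-walk cycleDist-diag cycleDist-edge

    dist≤n : ∀ v x → d v x ≤ n
    dist≤n v x = subst (_≤ n) (sym (dist≡cycleDist v x)) (arc≤n (offset<N v x))

    dist≡n⇒antipode : ∀ {v x} → d v x ≡ n → v ≡ antipode⁻ x ⊎ v ≡ antipode⁺ x
    dist≡n⇒antipode {v} {x} d≡n with arc≡n⇒n⊎1+n (offset<N v x) (trans (sym (dist≡cycleDist v x)) d≡n)
    ... | inj₁ o≡n   = inj₁ (trans (sym (rotate-offset v x)) (cong (λ t → rotate t x) o≡n))
    ... | inj₂ o≡1+n = inj₂ (trans (sym (rotate-offset v x)) (cong (λ t → rotate t x) o≡1+n))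

    dist-antipode⁻ : ∀ x → d (antipode⁻ x) x ≡ n
    dist-antipode⁻ x = begin
      d (rotate n x) x             ≡⟨ dist≡cycleDist _ x ⟩
      arc (offset (rotate n x) x)  ≡⟨ cong arc (offset-rotate n x) ⟩
      arc (n % N)                  ≡⟨ cong arc (m≤n⇒m%n≡m (m≤m+n n (n + 0))) ⟩
      arc n                        ≡⟨ arc-n ⟩
      n                            ∎
      where open ≡-Reasoning

    dist-antipode⁺ : ∀ x → d (antipode⁺ x) x ≡ n
    dist-antipode⁺ x = trans (dist≡cycleDist _ x) (trans (cong arc (offset-rotate (suc n) x)) arc-sucMod-n)

    dist-no-local-max : ∀ i y → d i y < n → d (next (next i)) y < n →
                        d (next i) y < d i y ⊎ d (next i) y < d (next (next i)) y
    dist-no-local-max i y d₀<n d₂<n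
      rewrite dist≡cycleDist i y | dist≡cycleDist (next i) y | dist≡cycleDist (next (next i)) y
            | offset-next (next i) y | offset-next i y
      = arc-no-local-max (offset<N i y) d₀<n d₂<n

    dist-antipode⁺-of : ∀ {u v} → v ≡ u ⊎ v ≡ next u → d v (antipode⁺ u) ≡ n
    dist-antipode⁺-of {u} (inj₁ refl) =
      trans (cong (λ z → d z (antipode⁺ u)) (sym (antipode⁻∘antipode⁺ u))) (dist-antipode⁻ _)
    dist-antipode⁺-of {u} (inj₂ refl) =
      trans (cong (λ z → d z (antipode⁺ u)) (sym (antipode⁺∘antipode⁺ u))) (dist-antipode⁺ _)

    ecc≤n : ∀ S v → ecc d S v ≤ n
    ecc≤n S v = ecc-lub d S (λ {x} _ → dist≤n v x)

    ⊤-isCenterSet : IsCenterSet d ⊤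
    ⊤-isCenterSet = ⊤ , (zero , ∈⊤) , λ v → mk⇔ (λ _ x → ≤-trans (ecc≤n ⊤ v) (n≤ecc x)) (λ _ → ∈⊤)
      where
      n≤ecc : ∀ x → n ≤ ecc d ⊤ x
      n≤ecc x = subst (_≤ ecc d ⊤ x) (dist-antipode⁺-of (inj₁ refl)) (dist≤ecc d ⊤ ∈⊤)

    centres-two-apart⇒n≤ecc : ∀ {S i} → Nonempty S → InCenter d S i → InCenter d S (next (next i)) →
                              n ≤ ecc d S i
    centres-two-apart⇒n≤ecc {S} {i} ne cᵢ c₂ with n ≤? ecc d S i
    ... | yes n≤E = n≤E
    ... | no  n≰E = contradiction (cᵢ (next i)) (<⇒≱ (ecc-lub< d S ne middle<))
      where
      E<n : ecc d S i < n
      E<n = ≰⇒> n≰E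
      middle< : ∀ {y} → y ∈ S → d (next i) y < ecc d S i
      middle< {y} y∈S with dist-no-local-max i y (≤-<-trans (dist≤ecc d S y∈S) E<n)
                                                   (≤-<-trans (dist≤ecc d S y∈S) (≤-<-trans (c₂ i) E<n))
      ... | inj₁ <d₀ = <-≤-trans <d₀ (dist≤ecc d S y∈S)
      ... | inj₂ <d₂ = <-≤-trans <d₂ (≤-trans (dist≤ecc d S y∈S) (c₂ i))

    n≤ecc⇒all-centres : ∀ {S i} → InCenter d S i → n ≤ ecc d S i → ∀ v → InCenter d S v
    n≤ecc⇒all-centres {S} cᵢ n≤E v x = ≤-trans (ecc≤n S v) (≤-trans n≤E (cᵢ x))

    isCenterSet⇒⊤⊎noAlternatePair : ∀ {A} → IsCenterSet d A → A ≡ ⊤ ⊎ NoAlternatePair A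
    isCenterSet⇒⊤⊎noAlternatePair {A} (S , ne , A⇔centre) with any? (λ i → (i ∈? A) ×-dec (next (next i) ∈? A))
    ... | no  noPair                = inj₂ noPair
    ... | yes (i , i∈A , i₂∈A) = inj₁ (⊆-antisym (λ _ → ∈⊤) (λ {v} _ → Equivalence.from (A⇔centre v) (all-centres v)))
      where
      centre : ∀ {v} → v ∈ A → InCenter d S v
      centre {v} = Equivalence.to (A⇔centre v)
      all-centres : ∀ v → InCenter d S v
      all-centres = n≤ecc⇒all-centres {S} (centre i∈A) (centres-two-apart⇒n≤ecc {S} ne (centre i∈A) (centre i₂∈A))

    module _ {A : Subset N} (nonempty : Nonempty A) (noPair : NoAlternatePair A) where

      private
        prev∉A : ∀ {v} → next v ∈ A → prev v ∉ A
        prev∉A {v} v₁∈A v₋∈A = noPair (prev v , v₋∈A , subst (λ t → next t ∈ A) (sym (next-prev v)) v₁∈A)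

        outside-consecutive : ∀ {v} → v ∉ A → ∃ λ u → u ∉ A × next u ∉ A × (v ≡ u ⊎ v ≡ next u)
        outside-consecutive {v} v∉A with next v ∈? A
        ... | no  v₁∉A = v , v∉A , v₁∉A , inj₁ refl
        ... | yes v₁∈A = prev v , prev∉A v₁∈A , subst (_∉ A) (sym (next-prev v)) v∉A , inj₂ (sym (next-prev v))

        outside-neighbour : ∀ {v} → v ∈ A → ∃ λ w → w ∉ A × OddCycle n w v
        outside-neighbour {v} v∈A with next v ∈? A
        ... | no  v₁∉A = next v , v₁∉A , inj₂ refl
        ... | yes v₁∈A = prev v , prev∉A v₁∈A , inj₁ (sym (next-prev v))

        AntipodesOutside : Fin N → Set
        AntipodesOutside x = antipode⁻ x ∉ A × antipode⁺ x ∉ A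

        antipodesOutside? : Decidable AntipodesOutside
        antipodesOutside? x = ¬? (antipode⁻ x ∈? A) ×-dec ¬? (antipode⁺ x ∈? A)

        S : Subset N
        S = subsetOf antipodesOutside?

        ∉A⇒far-in-S : ∀ {v} → v ∉ A → ∃ λ y → y ∈ S × d v y ≡ n
        ∉A⇒far-in-S v∉A with outside-consecutive v∉A
        ... | u , u∉A , u₁∉A , v≡ = antipode⁺ u , ∈-subsetOf⁺ antipodesOutside? antipodes∉A , dist-antipode⁺-of v≡
          where
          antipodes∉A : AntipodesOutside (antipode⁺ u)
          antipodes∉A = subst (_∉ A) (sym (antipode⁻∘antipode⁺ u)) u∉A
                      , subst (_∉ A) (sym (antipode⁺∘antipode⁺ u)) u₁∉A

        S-nonempty : Nonempty S
        S-nonempty with ¬∀⟶∃¬ N (_∈ A) (_∈? A) (λ all∈A → noPair (proj₁ nonempty , proj₂ nonempty , all∈A _))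
        ... | v , v∉A = proj₁ (∉A⇒far-in-S v∉A) , proj₁ (proj₂ (∉A⇒far-in-S v∉A))

        ∉A⇒n≤ecc : ∀ {v} → v ∉ A → n ≤ ecc d S v
        ∉A⇒n≤ecc {v} v∉A with ∉A⇒far-in-S v∉A
        ... | y , y∈S , d≡n = subst (_≤ ecc d S v) d≡n (dist≤ecc d S y∈S)

        ∈A⇒eca<n : ∀ {v} → v ∈ A → ecc d S v < n
        ∈A⇒eca<n {v} v∈A = ecc-lub< d S S-nonempty λ {x} x∈S →
          ≤∧≢⇒< (dist≤n v x) (λ d≡n → [ antipode⁻-outside x∈S , antipode⁺-outside x∈S ] (dist≡n⇒antipode d≡n))
          where
          antipode⁻-outside : ∀ {x} → x ∈ S → v ≢ antipode⁻ x
          antipode⁻-outside x∈S refl = proj₁ (∈-subsetOf⁻ antipodesOutside? x∈S) v∈A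
          antipode⁺-outside : ∀ {x} → x ∈ S → v ≢ antipode⁺ x
          antipode⁺-outside x∈S refl = proj₂ (∈-subsetOf⁻ antipodesOutside? x∈S) v∈A

        n≤suc-ecc : ∀ x → n ≤ suc (ecc d S x)
        n≤suc-ecc x with x ∈? A
        ... | no  x∉A = ≤-trans (∉A⇒n≤ecc x∉A) (n≤1+n _)
        ... | yes x∈A with outside-neighbour x∈A
        ...   | w , w∉A , edge = ≤-trans (∉A⇒n≤ecc w∉A) (ecc-edge isDist S edge)

        centre⇒∈A : ∀ v → InCenter d S v → v ∈ A
        centre⇒∈A v centre with v ∈? A
        ... | yes v∈A = v∈A
        ... | no  v∉A = contradiction (≤-trans (∉A⇒n≤ecc v∉A) (centre (proj₁ nonempty)))
                                      (<⇒≱ (∈A⇒eca<n (proj₂ nonempty)))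

      noAlternatePair⇒isCenterSet : IsCenterSet d A
      noAlternatePair⇒isCenterSet = S , S-nonempty , λ v →
        mk⇔ (λ v∈A x → ≤-pred (≤-trans (∈A⇒eca<n v∈A) (n≤suc-ecc x))) (centre⇒∈A v)

mainTheorem8 : (n : ℕ) (d : Fin (suc (2 * n)) → Fin (suc (2 * n)) → ℕ) →
    IsShortestPathDistance (OddCycle n) d →
    (A : Subset (suc (2 * n))) → Nonempty A →
    (IsCenterSet d A ⇔ ((A ≡ ⊤) ⊎ NoAlternatePair A))
mainTheorem8 n d isDist A nonempty =
  mk⇔ (isCenterSet⇒⊤⊎noAlternatePair n isDist)
      [ (λ { refl → ⊤-isCenterSet n isDist }) , noAlternatePair⇒isCenterSet n isDist nonempty ]
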